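{- Let $G$ be a connected graph with at least two vertices and maximum degree at least $3$. Then every $g\in\mathrm{Aut}(Y(G))$ and every isomorphism $g$ from $Y(G)$ onto $\tilde Y(G)$ is gadget-preserving, i.e., for every $u\in V(G)$ there is a $u^+\in V(G)$ with $\{g(x): x\in V(Y(u))\}=V(Y(u^+))$.
   Context: For each vertex $u$ of $G$ let $A(u)=\{a(u,v): uv\in E(G)\}$ and $B(u)=\{b(u,v): uv\in E(G)\}$ be sets of new pairwise distinct elements, and let $M(u)$ be the set of all subsets of $A(u)$ of even cardinality, each regarded as a new vertex. The gadget $Y(u)$ has vertex set $V(Y(u))=A(u)\cup B(u)\cup M(u)$ and, for $m\in M(u)$, the edge $\{a(u,v),m\}$ if $a(u,v)\in m$ and the edge $\{b(u,v),m\}$ if $a(u,v)\notin m$. $Y(G)$ is the disjoint union of all gadgets together with, for each edge $uv\in E(G)$, the edges $\{a(u,v),a(v,u)\}$ and $\{b(u,v),b(v,u)\}$. $\tilde Y(G)$ has the same vertex set and gadgets and is obtained by choosing one edge $u_0v_0$ of $G$ and replacing $\{a(u_0,v_0),a(v_0,u_0)\}$, $\{b(u_0,v_0),b(v_0,u_0)\}$ by $\{a(u_0,v_0),b(v_0,u_0)\}$, $\{b(u_0,v_0),a(v_0,u_0)\}$. -}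

module Defs where

open import Data.Bool using (Bool; true; false; T; _∧_; _∨_; not)
open import Data.Nat using (ℕ; zero; suc; _≤_; _%_)
open import Data.Nat.Base using (_≡ᵇ_)
open import Data.Fin using (Fin)
open import Data.Fin.Properties using (_≟_)
open import Data.Fin.Subset using (Subset; ∣_∣)
open import Data.Vec using (Vec; []; _∷_; lookup; tabulate)
open import Data.Product using (Σ; ∃; _×_; _,_)
open import Data.Sum using (_⊎_)
open import Relation.Nullary.Decidable using (⌊_⌋)
open import Relation.Binary.PropositionalEquality using (_≡_)
open import Function.Bundles using (_⤖_; Bijection)

record Graph (n : ℕ) : Set where
  field
    adj   : Fin n → Fin n → Bool
    sym   : ∀ u v → adj u v ≡ adj v u
    irrefl : ∀ u → adj u u ≡ false
open Graph public

module _ {n : ℕ} (G : Graph n) where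

  nbr : Fin n → Subset n
  nbr u = tabulate (adj G u)

  data Walk : Fin n → Fin n → Set where
    here : ∀ {u} → Walk u u
    step : ∀ {u v w} → T (adj G u v) → Walk v w → Walk u w

  Connected : Set
  Connected = ∀ u v → Walk u v

  MaxDegree≥3 : Set
  MaxDegree≥3 = ∃ λ u → 3 ≤ ∣ nbr u ∣

subsetᵇ : ∀ {k} → Vec Bool k → Vec Bool k → Bool
subsetᵇ [] [] = true
subsetᵇ (x ∷ xs) (y ∷ ys) = (not x ∨ y) ∧ subsetᵇ xs ys

evenᵇ : ℕ → Bool
evenᵇ k = (k % 2) ≡ᵇ 0

module _ {n : ℕ} (G : Graph n) where

  -- S ⊆ N(u) with |S| even; such S correspond to the even subsets
  -- {a(u,v) : v ∈ S} of A(u).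
  EvenSub : Fin n → Subset n → Bool
  EvenSub u S = subsetᵇ S (nbr G u) ∧ evenᵇ ∣ S ∣

  data YV : Set where
    a : (u v : Fin n) → T (adj G u v) → YV
    b : (u v : Fin n) → T (adj G u v) → YV
    m : (u : Fin n) (S : Subset n) → T (EvenSub u S) → YV

  owner : YV → Fin n
  owner (a u _ _) = u
  owner (b u _ _) = u
  owner (m u _ _) = u

  -- generating (directed) edges; tw u v = true marks a twisted edge of G
  data Gen (tw : Fin n → Fin n → Bool) : YV → YV → Set where
    am : ∀ {u v p S q} → lookup S v ≡ true  → Gen tw (a u v p) (m u S q)
    bm : ∀ {u v p S q} → lookup S v ≡ false → Gen tw (b u v p) (m u S q)
    aa : ∀ {u v p p'} → tw u v ≡ false → Gen tw (a u v p) (a v u p')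
    bb : ∀ {u v p p'} → tw u v ≡ false → Gen tw (b u v p) (b v u p')
    ab : ∀ {u v p p'} → tw u v ≡ true  → Gen tw (a u v p) (b v u p')
    ba : ∀ {u v p p'} → tw u v ≡ true  → Gen tw (b u v p) (a v u p')

  Edge : (Fin n → Fin n → Bool) → YV → YV → Set
  Edge tw x y = Gen tw x y ⊎ Gen tw y x

  EY : YV → YV → Set
  EY = Edge (λ _ _ → false)

  twist : Fin n → Fin n → Fin n → Fin n → Bool
  twist u0 v0 u v = (⌊ u ≟ u0 ⌋ ∧ ⌊ v ≟ v0 ⌋) ∨ (⌊ u ≟ v0 ⌋ ∧ ⌊ v ≟ u0 ⌋)

  EỸ : (u0 v0 : Fin n) → YV → YV → Set
  EỸ u0 v0 = Edge (twist u0 v0)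

  record Iso (E F : YV → YV → Set) : Set where
    field
      bij  : YV ⤖ YV
    g : YV → YV
    g = Bijection.to bij
    field
      pres : ∀ x y → E x y → F (g x) (g y)
      refl : ∀ x y → F (g x) (g y) → E x y

  GadgetPreserving : ∀ {E F} → Iso E F → Set
  GadgetPreserving φ =
    ∀ u → ∃ λ u⁺ →
      (∀ x → owner x ≡ u → owner (Iso.g φ x) ≡ u⁺) ×
      (∀ y → owner y ≡ u⁺ → ∃ λ x → owner x ≡ u × Iso.g φ x ≡ y)

{-# OPTIONS --safe #-}
-- Lying in the same gadget is characterised by an equivalence relation ∼ generated by rules
-- that mention only edges and (in)equality of vertices, so every isomorphism between Y(G) and
-- Y(G) or Ỹ(G) preserves ∼. Soundness rests on the shape of Y(G): the edges between gadgets
-- form a perfect matching of the ports a(u,v), b(u,v), and M(u) is joined only to ports of u;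
-- hence a short cycle (hexagon) or a vertex with two ∼-related neighbours (fork) cannot leave
-- a gadget. For completeness, hexagons and forks link all of Y(u) when deg u ≥ 3. When
-- deg u ≤ 2, Y(u) falls apart into paths, and we reach it along a path of vertices of degree
-- ≤ 2 from a vertex x of degree ≥ 3, which exists as G is connected. Two ∼-related vertices of
-- degree ≥ 3 without common neighbour, such as a(x,w) and b(x,w), have their low neighbours
-- in one gadget at the same pair of ports; as each gadget on the path has only one way on,
-- the two non-backtracking walks leaving them (Parallel) stay side by side and reach both
-- halves of Y(u).

module Submission where

open import Defs hiding (sym)
open import Data.Bool using (Bool; true; false; T; _∧_; _∨_; not; _xor_)
open import Data.Bool.Properties using () renaming (_≟_ to _≟ᵇ_)
open import Data.Bool.Properties
  using ( T?; T-≡; T-∧; T-irrelevant; not-¬; ¬-not; not-distribˡ-xor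
        ; xor-assoc; xor-same; xor-identityʳ; ∧-comm; ∨-comm; ∨-zeroʳ )
open import Data.Nat using (ℕ; zero; suc; _≤_; _+_; s≤s)
open import Data.Nat.Properties using (+-comm)
open import Data.Fin using (Fin; zero; suc)
open import Data.Fin.Properties using (_≟_; any?; suc-injective; 0≢1+n)
open import Data.Fin.Subset using (Subset; ∣_∣; ⊥)
open import Data.Fin.Subset.Properties using (∣⊥∣≡0)
open import Data.Vec using (Vec; []; _∷_; lookup; tabulate)
open import Data.Vec.Properties using (lookup∘tabulate; tabulate∘lookup; tabulate-cong; lookup-replicate)
open import Data.Product using (Σ; ∃; ∃₂; _×_; _,_; proj₁; proj₂)
open import Data.Sum using (_⊎_; inj₁; inj₂; [_,_])
import Data.Sum as ⊎
open import Data.Empty using (⊥-elim)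
open import Function using (_∘_; flip)
open import Function.Bundles using (Inverse; Equivalence; _↔_)
open import Function.Construct.Symmetry using (↔-sym)
open import Function.Properties.Bijection using (⤖⇒↔)
open import Relation.Nullary using (¬_; Dec; does; yes; no)
open import Relation.Nullary.Decidable using (⌊_⌋; _×-dec_; ¬?; dec-true; dec-false)
open import Relation.Binary.Definitions using (DecidableEquality)
open import Relation.Binary.PropositionalEquality
  using (_≡_; _≢_; refl; sym; trans; cong; cong₂; subst; subst₂; module ≡-Reasoning)

module _ {A : Set} where

  Has≥3 : (A → Set) → Set
  Has≥3 P = ∃ λ y₁ → ∃₂ λ y₂ y₃ → P y₁ × P y₂ × P y₃ × y₁ ≢ y₂ × y₁ ≢ y₃ × y₂ ≢ y₃

  Has≤2 : (A → Set) → Set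
  Has≤2 P = ∀ {y₁ y₂ y₃} → P y₁ → P y₂ → P y₃ → y₁ ≡ y₂ ⊎ y₁ ≡ y₃ ⊎ y₂ ≡ y₃

  Has≥3-map : ∀ {P Q} → (∀ {y} → P y → Q y) → Has≥3 P → Has≥3 Q
  Has≥3-map f (y₁ , y₂ , y₃ , p₁ , p₂ , p₃ , distinct) = y₁ , y₂ , y₃ , f p₁ , f p₂ , f p₃ , distinct

  Has≥3⇒¬Has≤2 : ∀ {P} → Has≥3 P → ¬ Has≤2 P
  Has≥3⇒¬Has≤2 (_ , _ , _ , p₁ , p₂ , p₃ , y₁≢y₂ , y₁≢y₃ , y₂≢y₃) ≤2 =
    [ y₁≢y₂ , [ y₁≢y₃ , y₂≢y₃ ] ] (≤2 p₁ p₂ p₃)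

  ¬Has≥3⇒Has≤2 : DecidableEquality A → ∀ {P} → ¬ Has≥3 P → Has≤2 P
  ¬Has≥3⇒Has≤2 _≟_ ¬≥3 {y₁} {y₂} {y₃} p₁ p₂ p₃ with y₁ ≟ y₂ | y₁ ≟ y₃ | y₂ ≟ y₃
  ... | yes e | _ | _ = inj₁ e
  ... | no _ | yes e | _ = inj₂ (inj₁ e)
  ... | no _ | no _ | yes e = inj₂ (inj₂ e)
  ... | no y₁≢y₂ | no y₁≢y₃ | no y₂≢y₃ =
    ⊥-elim (¬≥3 (y₁ , y₂ , y₃ , p₁ , p₂ , p₃ , y₁≢y₂ , y₁≢y₃ , y₂≢y₃))

  Has≥3⇒another : DecidableEquality A → ∀ {P} → Has≥3 P → ∀ v v' → ∃ λ w → P w × w ≢ v × w ≢ v'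
  Has≥3⇒another _≟_ (y₁ , y₂ , y₃ , p₁ , p₂ , p₃ , y₁≢y₂ , y₁≢y₃ , y₂≢y₃) v v'
    with y₁ ≟ v | y₁ ≟ v' | y₂ ≟ v | y₂ ≟ v'
  ... | no y₁≢v | no y₁≢v' | _ | _ = y₁ , p₁ , y₁≢v , y₁≢v'
  ... | _ | _ | no y₂≢v | no y₂≢v' = y₂ , p₂ , y₂≢v , y₂≢v'
  ... | yes refl | _ | _ | yes refl = y₃ , p₃ , y₁≢y₃ ∘ sym , y₂≢y₃ ∘ sym
  ... | _ | yes refl | yes refl | _ = y₃ , p₃ , y₂≢y₃ ∘ sym , y₁≢y₃ ∘ sym
  ... | yes refl | no _ | yes refl | no _ = ⊥-elim (y₁≢y₂ refl)
  ... | no _ | yes refl | no _ | yes refl = ⊥-elim (y₁≢y₂ refl)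

bool→ℕ : Bool → ℕ
bool→ℕ true = 1
bool→ℕ false = 0

xor-cancelʳ : ∀ k c → (k xor c) xor c ≡ k
xor-cancelʳ k c = trans (xor-assoc k c c) (trans (cong (k xor_) (xor-same c)) (xor-identityʳ k))

lookup-ext : ∀ {A : Set} {k} (xs ys : Vec A k) → (∀ i → lookup xs i ≡ lookup ys i) → xs ≡ ys
lookup-ext xs ys eq = begin
  xs                  ≡⟨ tabulate∘lookup xs ⟨
  tabulate (lookup xs) ≡⟨ tabulate-cong eq ⟩
  tabulate (lookup ys) ≡⟨ tabulate∘lookup ys ⟩
  ys                  ∎
  where open ≡-Reasoning

∣∷∣ : ∀ {k} s (S : Subset k) → ∣ s ∷ S ∣ ≡ bool→ℕ s + ∣ S ∣
∣∷∣ true S = refl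
∣∷∣ false S = refl

∣∣≡0 : ∀ {k} (S : Subset k) → (∀ y → lookup S y ≢ true) → ∣ S ∣ ≡ 0
∣∣≡0 [] _ = refl
∣∣≡0 (true ∷ S) ∉S = ⊥-elim (∉S zero refl)
∣∣≡0 (false ∷ S) ∉S = ∣∣≡0 S (∉S ∘ suc)

∣∣-⊆⁅v⁆ : ∀ {k} (S : Subset k) v → (∀ y → lookup S y ≡ true → y ≡ v) →
  ∣ S ∣ ≡ bool→ℕ (lookup S v)
∣∣-⊆⁅v⁆ (true ∷ S) zero ⊆v = cong suc (∣∣≡0 S λ y → 0≢1+n ∘ sym ∘ ⊆v (suc y))
∣∣-⊆⁅v⁆ (false ∷ S) zero ⊆v = ∣∣≡0 S λ y → 0≢1+n ∘ sym ∘ ⊆v (suc y)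
∣∣-⊆⁅v⁆ (true ∷ S) (suc v) ⊆v with () ← ⊆v zero refl
∣∣-⊆⁅v⁆ (false ∷ S) (suc v) ⊆v = ∣∣-⊆⁅v⁆ S v λ y → suc-injective ∘ ⊆v (suc y)

∣∣-⊆⁅v,w⁆ : ∀ {k} (S : Subset k) {v w} → v ≢ w → (∀ y → lookup S y ≡ true → y ≡ v ⊎ y ≡ w) →
  ∣ S ∣ ≡ bool→ℕ (lookup S v) + bool→ℕ (lookup S w)
∣∣-⊆⁅v,w⁆ S {zero} {zero} v≢w _ = ⊥-elim (v≢w refl)
∣∣-⊆⁅v,w⁆ (s ∷ S) {zero} {suc w} _ ⊆vw =
  trans (∣∷∣ s S) (cong (bool→ℕ s +_) (∣∣-⊆⁅v⁆ S w λ y →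
    [ ⊥-elim ∘ 0≢1+n ∘ sym , suc-injective ] ∘ ⊆vw (suc y)))
∣∣-⊆⁅v,w⁆ (s ∷ S) {suc v} {zero} _ ⊆vw =
  trans (∣∷∣ s S) (trans (cong (bool→ℕ s +_) (∣∣-⊆⁅v⁆ S v λ y →
    [ suc-injective , ⊥-elim ∘ 0≢1+n ∘ sym ] ∘ ⊆vw (suc y))) (+-comm (bool→ℕ s) _))
∣∣-⊆⁅v,w⁆ (true ∷ S) {suc v} {suc w} _ ⊆vw with ⊆vw zero refl
... | inj₁ ()
... | inj₂ ()
∣∣-⊆⁅v,w⁆ (false ∷ S) {suc v} {suc w} v≢w ⊆vw =
  ∣∣-⊆⁅v,w⁆ S (v≢w ∘ cong suc) λ y e → ⊎.map suc-injective suc-injective (⊆vw (suc y) e)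

even⇒≡ : ∀ b c → T (evenᵇ (bool→ℕ b + bool→ℕ c)) → b ≡ c
even⇒≡ true true _ = refl
even⇒≡ false false _ = refl

subsetᵇ⇒⊆ : ∀ {k} (S U : Subset k) → T (subsetᵇ S U) → ∀ y → lookup S y ≡ true → lookup U y ≡ true
subsetᵇ⇒⊆ (true ∷ S) (true ∷ U) _ zero _ = refl
subsetᵇ⇒⊆ (s ∷ S) (u ∷ U) S⊆U (suc y) = subsetᵇ⇒⊆ S U (proj₂ (Equivalence.to T-∧ S⊆U)) y

⊆⇒subsetᵇ : ∀ {k} (S U : Subset k) → (∀ y → lookup S y ≡ true → lookup U y ≡ true) → T (subsetᵇ S U)
⊆⇒subsetᵇ [] [] _ = _
⊆⇒subsetᵇ (true ∷ S) (u ∷ U) S⊆U rewrite S⊆U zero refl = ⊆⇒subsetᵇ S U (S⊆U ∘ suc)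
⊆⇒subsetᵇ (false ∷ S) (u ∷ U) S⊆U = ⊆⇒subsetᵇ S U (S⊆U ∘ suc)

member : ∀ {k} (S : Subset k) → 1 ≤ ∣ S ∣ → ∃ λ y → lookup S y ≡ true
member (true ∷ S) _ = zero , refl
member (false ∷ S) 1≤∣S∣ = let y , y∈S = member S 1≤∣S∣ in suc y , y∈S

two-members : ∀ {k} (S : Subset k) → 2 ≤ ∣ S ∣ → ∃₂ λ y₁ y₂ →
  lookup S y₁ ≡ true × lookup S y₂ ≡ true × y₁ ≢ y₂
two-members (true ∷ S) (s≤s 1≤∣S∣) = let y , y∈S = member S 1≤∣S∣ in zero , suc y , refl , y∈S , 0≢1+n
two-members (false ∷ S) 2≤∣S∣ =
  let y₁ , y₂ , y₁∈S , y₂∈S , y₁≢y₂ = two-members S 2≤∣S∣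
  in suc y₁ , suc y₂ , y₁∈S , y₂∈S , y₁≢y₂ ∘ suc-injective

three-members : ∀ {k} (S : Subset k) → 3 ≤ ∣ S ∣ → Has≥3 (λ y → lookup S y ≡ true)
three-members (true ∷ S) (s≤s 2≤∣S∣) =
  let y₁ , y₂ , y₁∈S , y₂∈S , y₁≢y₂ = two-members S 2≤∣S∣
  in zero , suc y₁ , suc y₂ , refl , y₁∈S , y₂∈S , 0≢1+n , 0≢1+n , y₁≢y₂ ∘ suc-injective
three-members (false ∷ S) 3≤∣S∣ =
  let y₁ , y₂ , y₃ , y₁∈S , y₂∈S , y₃∈S , y₁≢y₂ , y₁≢y₃ , y₂≢y₃ = three-members S 3≤∣S∣
  in suc y₁ , suc y₂ , suc y₃ , y₁∈S , y₂∈S , y₃∈S ,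
     y₁≢y₂ ∘ suc-injective , y₁≢y₃ ∘ suc-injective , y₂≢y₃ ∘ suc-injective

module Intrinsic {V : Set} (E : V → V → Set) where

  High : V → Set
  High x = Has≥3 (E x)

  Low : V → Set
  Low x = Has≤2 (E x)

  NoCommonNeighbour : V → V → Set
  NoCommonNeighbour x x' = ∀ z → E x z → ¬ E x' z

  Forward : V → V → V → Set
  Forward x y z = E y z × z ≢ x

  Advance : V → V → V → V → Set
  Advance x y w t = ∃ λ z → Forward x y z × Forward y z w × Forward z w t × Low t

  infix 4 _∼_
  data _∼_ : V → V → Set
  data Parallel : V → V → V → V → Set

  data _∼_ where
    ∼-refl : ∀ {x} → x ∼ x
    ∼-sym : ∀ {x y} → x ∼ y → y ∼ x
    ∼-trans : ∀ {x y z} → x ∼ y → y ∼ z → x ∼ z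
    hexagon : ∀ {x₀ x₁ x₂ x₃ x₄ x₅} →
      E x₀ x₁ → E x₁ x₂ → E x₂ x₃ → E x₃ x₄ → E x₄ x₅ → E x₅ x₀ →
      x₅ ≢ x₁ → x₂ ≢ x₀ → x₁ ≢ x₃ → x₀ ∼ x₁
    fork : ∀ {z x y} → E z x → E z y → x ≢ y → x ∼ y → z ∼ x
    parallel : ∀ {x y x' y'} → Parallel x y x' y' → y ∼ y'
    forward₁ : ∀ {x y x' y' z} → Parallel x y x' y' → Forward x y z → y ∼ z
    forward₂ : ∀ {x y x' y' z w} → Parallel x y x' y' → Forward x y z → Forward y z w → z ∼ w

  data Parallel where
    root : ∀ {h h' y y'} → High h → High h' → h ∼ h' → NoCommonNeighbour h h' →
      E h y → E h' y' → Low y → Low y' → Parallel h y h' y'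
    advance : ∀ {x y x' y' w t w' t'} →
      Parallel x y x' y' → Advance x y w t → Advance x' y' w' t' → Parallel w t w' t'

  ∼-reflexive : ∀ {x y} → x ≡ y → x ∼ y
  ∼-reflexive refl = ∼-refl

  hexagon-links : ∀ {x₀ x₁ x₂ x₃ x₄ x₅} →
    E x₀ x₁ → E x₁ x₂ → E x₂ x₃ → E x₃ x₄ → E x₄ x₅ → E x₅ x₀ →
    x₀ ≢ x₂ → x₁ ≢ x₃ → x₂ ≢ x₄ → x₃ ≢ x₅ → x₄ ≢ x₀ → x₅ ≢ x₁ →
    x₀ ∼ x₁ × x₁ ∼ x₂ × x₂ ∼ x₃ × x₃ ∼ x₄ × x₄ ∼ x₅ × x₅ ∼ x₀
  hexagon-links e₀ e₁ e₂ e₃ e₄ e₅ d₀ d₁ d₂ d₃ d₄ d₅ =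
    hexagon e₀ e₁ e₂ e₃ e₄ e₅ d₅ (d₀ ∘ sym) d₁ ,
    hexagon e₁ e₂ e₃ e₄ e₅ e₀ d₀ (d₁ ∘ sym) d₂ ,
    hexagon e₂ e₃ e₄ e₅ e₀ e₁ d₁ (d₂ ∘ sym) d₃ ,
    hexagon e₃ e₄ e₅ e₀ e₁ e₂ d₂ (d₃ ∘ sym) d₄ ,
    hexagon e₄ e₅ e₀ e₁ e₂ e₃ d₃ (d₄ ∘ sym) d₅ ,
    hexagon e₅ e₀ e₁ e₂ e₃ e₄ d₄ (d₅ ∘ sym) d₀

  Parallel-swap : ∀ {x y x' y'} → Parallel x y x' y' → Parallel x' y' x y
  Parallel-swap (root hh hh' h∼h' nc hy h'y' ly ly') =
    root hh' hh (∼-sym h∼h') (flip ∘ nc) h'y' hy ly' ly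
  Parallel-swap (advance par adv adv') = advance (Parallel-swap par) adv' adv

record GraphIso {V W : Set} (E : V → V → Set) (F : W → W → Set) : Set where
  field
    bijection : V ↔ W
  open Inverse bijection public using (to; from; strictlyInverseˡ; strictlyInverseʳ)
  field
    preserves : ∀ {x y} → E x y → F (to x) (to y)
    reflects : ∀ {x y} → F (to x) (to y) → E x y

  to-injective : ∀ {x y} → to x ≡ to y → x ≡ y
  to-injective {x} {y} eq = trans (sym (strictlyInverseʳ x)) (trans (cong from eq) (strictlyInverseʳ y))

  inverse : GraphIso F E
  inverse = record
    { bijection = ↔-sym bijection
    ; preserves = λ {x} {y} e →
        reflects (subst₂ F (sym (strictlyInverseˡ x)) (sym (strictlyInverseˡ y)) e)
    ; reflects = λ {x} {y} e → subst₂ F (strictlyInverseˡ x) (strictlyInverseˡ y) (preserves e)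
    }

module _ {V W : Set} {E : V → V → Set} {F : W → W → Set} (φ : GraphIso E F) where
  open GraphIso φ
  open Intrinsic E
  module F = Intrinsic F

  private
    ≢-preserved : ∀ {x y} → x ≢ y → to x ≢ to y
    ≢-preserved x≢y = x≢y ∘ to-injective

    from-injective : ∀ {y y'} → from y ≡ from y' → y ≡ y'
    from-injective {y} {y'} eq =
      trans (sym (strictlyInverseˡ y)) (trans (cong to eq) (strictlyInverseˡ y'))

    reflects-from : ∀ {x y} → F (to x) y → E x (from y)
    reflects-from {x} {y} e = reflects (subst (F (to x)) (sym (strictlyInverseˡ y)) e)

  High-preserved : ∀ {x} → High x → F.High (to x)
  High-preserved (y₁ , y₂ , y₃ , e₁ , e₂ , e₃ , y₁≢y₂ , y₁≢y₃ , y₂≢y₃) =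
    to y₁ , to y₂ , to y₃ , preserves e₁ , preserves e₂ , preserves e₃ ,
    ≢-preserved y₁≢y₂ , ≢-preserved y₁≢y₃ , ≢-preserved y₂≢y₃

  Low-preserved : ∀ {x} → Low x → F.Low (to x)
  Low-preserved low f₁ f₂ f₃ =
    ⊎.map from-injective (⊎.map from-injective from-injective)
      (low (reflects-from f₁) (reflects-from f₂) (reflects-from f₃))

  NoCommonNeighbour-preserved : ∀ {x x'} → NoCommonNeighbour x x' → F.NoCommonNeighbour (to x) (to x')
  NoCommonNeighbour-preserved nc z e e' = nc (from z) (reflects-from e) (reflects-from e')

  Forward-preserved : ∀ {x y z} → Forward x y z → F.Forward (to x) (to y) (to z)
  Forward-preserved (e , z≢x) = preserves e , ≢-preserved z≢x

  Advance-preserved : ∀ {x y w t} → Advance x y w t → F.Advance (to x) (to y) (to w) (to t)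
  Advance-preserved (z , f₁ , f₂ , f₃ , low) =
    to z , Forward-preserved f₁ , Forward-preserved f₂ , Forward-preserved f₃ , Low-preserved low

  ∼-preserved : ∀ {x y} → x ∼ y → to x F.∼ to y
  Parallel-preserved : ∀ {x y x' y'} → Parallel x y x' y' → F.Parallel (to x) (to y) (to x') (to y')
  ∼-preserved ∼-refl = F.∼-refl
  ∼-preserved (∼-sym r) = F.∼-sym (∼-preserved r)
  ∼-preserved (∼-trans r r') = F.∼-trans (∼-preserved r) (∼-preserved r')
  ∼-preserved (hexagon e₀ e₁ e₂ e₃ e₄ e₅ n₁ n₂ n₃) =
    F.hexagon (preserves e₀) (preserves e₁) (preserves e₂) (preserves e₃) (preserves e₄) (preserves e₅)
              (≢-preserved n₁) (≢-preserved n₂) (≢-preserved n₃)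
  ∼-preserved (fork e₁ e₂ x≢y r) = F.fork (preserves e₁) (preserves e₂) (≢-preserved x≢y) (∼-preserved r)
  ∼-preserved (parallel par) = F.parallel (Parallel-preserved par)
  ∼-preserved (forward₁ par f) = F.forward₁ (Parallel-preserved par) (Forward-preserved f)
  ∼-preserved (forward₂ par f f') =
    F.forward₂ (Parallel-preserved par) (Forward-preserved f) (Forward-preserved f')
  Parallel-preserved (root hh hh' r nc e e' l l') =
    F.root (High-preserved hh) (High-preserved hh') (∼-preserved r) (NoCommonNeighbour-preserved nc)
           (preserves e) (preserves e') (Low-preserved l) (Low-preserved l')
  Parallel-preserved (advance par adv adv') =
    F.advance (Parallel-preserved par) (Advance-preserved adv) (Advance-preserved adv')

module Gadgets {n : ℕ} (G : Graph n) where

  V : Set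
  V = YV G

  Adj : Fin n → Fin n → Set
  Adj u v = T (adj G u v)

  adj-sym : ∀ {u v} → Adj u v → Adj v u
  adj-sym {u} {v} = subst T (Graph.sym G u v)

  adj⇒≢ : ∀ {u v} → Adj u v → u ≢ v
  adj⇒≢ {u} p refl = subst T (Graph.irrefl G u) p

  ∈nbr⇒Adj : ∀ {u y} → lookup (nbr G u) y ≡ true → Adj u y
  ∈nbr⇒Adj {u} {y} y∈N = Equivalence.from T-≡ (trans (sym (lookup∘tabulate (adj G u) y)) y∈N)

  Adj⇒∈nbr : ∀ {u y} → Adj u y → lookup (nbr G u) y ≡ true
  Adj⇒∈nbr {u} {y} p = trans (lookup∘tabulate (adj G u) y) (Equivalence.to T-≡ p)

  port : Bool → (u v : Fin n) → Adj u v → V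
  port true = a
  port false = b

  owner-port : ∀ k u v p → owner G (port k u v p) ≡ u
  owner-port true _ _ _ = refl
  owner-port false _ _ _ = refl

  port-cong : ∀ k {u v v'} {p : Adj u v} {p' : Adj u v'} → v ≡ v' → port k u v p ≡ port k u v' p'
  port-cong k {p = p} {p'} refl = cong (port k _ _) (T-irrelevant p p')

  port-injective : ∀ {k k' u u' v v' p p'} → port k u v p ≡ port k' u' v' p' →
    k ≡ k' × u ≡ u' × v ≡ v'
  port-injective {true} {true} refl = refl , refl , refl
  port-injective {false} {false} refl = refl , refl , refl

  m≢port : ∀ {k u v p u' S q} → m u' S q ≢ port k u v p
  m≢port {true} ()
  m≢port {false} ()

  m-cong : ∀ {u S S' q q'} → S ≡ S' → _≡_ {A = V} (m u S q) (m u S' q')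
  m-cong {q = q} {q'} refl = cong (m _ _) (T-irrelevant q q')

  m-injective : ∀ {u u' S S' q q'} → _≡_ {A = V} (m u S q) (m u' S' q') → S ≡ S'
  m-injective refl = refl

  m-separated : ∀ {u S S' q q' y} → lookup S y ≡ true → lookup S' y ≡ false → m u S q ≢ m u S' q'
  m-separated {y = y} y∈S y∉S' eq = not-¬ y∈S (trans (cong (λ S → lookup S y) (m-injective eq)) y∉S')

  port-target-injective : ∀ {k k' u u' v v' p p'} → port k u v p ≡ port k' u' v' p' → v ≡ v'
  port-target-injective = proj₂ ∘ proj₂ ∘ port-injective

  Deg≥3 : Fin n → Set
  Deg≥3 u = Has≥3 (Adj u)

  Deg≤2 : Fin n → Set
  Deg≤2 u = Has≤2 (Adj u)

  Deg≥3? : ∀ u → Dec (Deg≥3 u)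
  Deg≥3? u = any? λ v₁ → any? λ v₂ → any? λ v₃ →
    T? (adj G u v₁) ×-dec T? (adj G u v₂) ×-dec T? (adj G u v₃) ×-dec
    ¬? (v₁ ≟ v₂) ×-dec ¬? (v₁ ≟ v₃) ×-dec ¬? (v₂ ≟ v₃)

  ¬Deg≥3⇒Deg≤2 : ∀ {u} → ¬ Deg≥3 u → Deg≤2 u
  ¬Deg≥3⇒Deg≤2 = ¬Has≥3⇒Has≤2 _≟_

  ∣nbr∣≥3⇒Deg≥3 : ∀ {u} → 3 ≤ ∣ nbr G u ∣ → Deg≥3 u
  ∣nbr∣≥3⇒Deg≥3 {u} 3≤∣N∣ = Has≥3-map ∈nbr⇒Adj (three-members (nbr G u) 3≤∣N∣)

  another-neighbour : ∀ {u} → Deg≥3 u → ∀ v v' → ∃ λ w → Adj u w × w ≢ v × w ≢ v'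
  another-neighbour = Has≥3⇒another _≟_

  two-other-neighbours : ∀ {u} → Deg≥3 u → ∀ v → ∃₂ λ w x →
    Adj u w × Adj u x × w ≢ x × w ≢ v × x ≢ v
  two-other-neighbours deg v =
    let w , pw , w≢v , _ = another-neighbour deg v v
        x , px , x≢v , x≢w = another-neighbour deg v w
    in w , x , pw , px , x≢w ∘ sym , w≢v , x≢v

  Even : Fin n → Subset n → Set
  Even u S = T (EvenSub G u S)

  even⇒⊆nbr : ∀ {u} {S : Subset n} → Even u S → ∀ y → lookup S y ≡ true → Adj u y
  even⇒⊆nbr {u} {S} q y y∈S = ∈nbr⇒Adj (subsetᵇ⇒⊆ S (nbr G u) (proj₁ (Equivalence.to T-∧ q)) y y∈S)

  ⊥-even : ∀ u → Even u ⊥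
  ⊥-even u = Equivalence.from T-∧
    ( ⊆⇒subsetᵇ ⊥ (nbr G u) (λ y y∈⊥ → ⊥-elim (not-¬ (lookup-replicate y false) y∈⊥))
    , subst (T ∘ evenᵇ) (sym (∣⊥∣≡0 n)) _ )

  ⁅_,_⁆ : Fin n → Fin n → Subset n
  ⁅ v , w ⁆ = tabulate λ y → does (y ≟ v) ∨ does (y ≟ w)

  lookup-⁅,⁆ : ∀ v w y → lookup ⁅ v , w ⁆ y ≡ (does (y ≟ v) ∨ does (y ≟ w))
  lookup-⁅,⁆ v w = lookup∘tabulate _

  ∈⁅,⁆ˡ : ∀ v w → lookup ⁅ v , w ⁆ v ≡ true
  ∈⁅,⁆ˡ v w = trans (lookup-⁅,⁆ v w v) (cong (_∨ does (v ≟ w)) (dec-true (v ≟ v) refl))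

  ∈⁅,⁆ʳ : ∀ v w → lookup ⁅ v , w ⁆ w ≡ true
  ∈⁅,⁆ʳ v w =
    trans (lookup-⁅,⁆ v w w) (trans (cong (does (w ≟ v) ∨_) (dec-true (w ≟ w) refl)) (∨-zeroʳ _))

  ∉⁅,⁆ : ∀ {v w y} → y ≢ v → y ≢ w → lookup ⁅ v , w ⁆ y ≡ false
  ∉⁅,⁆ {v} {w} {y} y≢v y≢w =
    trans (lookup-⁅,⁆ v w y) (cong₂ _∨_ (dec-false (y ≟ v) y≢v) (dec-false (y ≟ w) y≢w))

  ⁅,⁆-⊆ : ∀ v w y → lookup ⁅ v , w ⁆ y ≡ true → y ≡ v ⊎ y ≡ w
  ⁅,⁆-⊆ v w y y∈ with y ≟ v | y ≟ w
  ... | yes y≡v | _ = inj₁ y≡v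
  ... | no _ | yes y≡w = inj₂ y≡w
  ... | no y≢v | no y≢w = ⊥-elim (not-¬ (∉⁅,⁆ y≢v y≢w) y∈)

  ⁅,⁆-even : ∀ {u v w} → Adj u v → Adj u w → v ≢ w → Even u ⁅ v , w ⁆
  ⁅,⁆-even {u} {v} {w} pv pw v≢w = Equivalence.from T-∧
    ( ⊆⇒subsetᵇ ⁅ v , w ⁆ (nbr G u) (λ y y∈ → Adj⇒∈nbr (adj-of y (⁅,⁆-⊆ v w y y∈)))
    , subst (T ∘ evenᵇ) (sym ∣⁅v,w⁆∣≡2) _ )
    where
      adj-of : ∀ y → y ≡ v ⊎ y ≡ w → Adj u y
      adj-of _ (inj₁ refl) = pv
      adj-of _ (inj₂ refl) = pw
      ∣⁅v,w⁆∣≡2 : ∣ ⁅ v , w ⁆ ∣ ≡ 2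
      ∣⁅v,w⁆∣≡2 = trans (∣∣-⊆⁅v,w⁆ ⁅ v , w ⁆ v≢w (⁅,⁆-⊆ v w))
                        (cong₂ (λ x y → bool→ℕ x + bool→ℕ y) (∈⁅,⁆ˡ v w) (∈⁅,⁆ʳ v w))

  even-agreeing : ∀ {u v w} → Adj u v → Adj u w → v ≢ w → ∀ k →
    Σ (Subset n) λ S → Even u S × lookup S v ≡ k × lookup S w ≡ k
  even-agreeing {u} {v} {w} pv pw v≢w true = ⁅ v , w ⁆ , ⁅,⁆-even pv pw v≢w , ∈⁅,⁆ˡ v w , ∈⁅,⁆ʳ v w
  even-agreeing {u} {v} {w} _ _ _ false =
    ⊥ , ⊥-even u , lookup-replicate v false , lookup-replicate w false

  even-prescribed : ∀ {u v w} → Deg≥3 u → Adj u v → Adj u w → v ≢ w → ∀ k k' →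
    Σ (Subset n) λ S → Even u S × lookup S v ≡ k × lookup S w ≡ k'
  even-prescribed _ pv pw v≢w true true = even-agreeing pv pw v≢w true
  even-prescribed _ pv pw v≢w false false = even-agreeing pv pw v≢w false
  even-prescribed {v = v} {w} deg pv pw v≢w true false =
    let x , px , x≢v , x≢w = another-neighbour deg v w
    in ⁅ v , x ⁆ , ⁅,⁆-even pv px (x≢v ∘ sym) , ∈⁅,⁆ˡ v x , ∉⁅,⁆ (v≢w ∘ sym) (x≢w ∘ sym)
  even-prescribed {v = v} {w} deg pv pw v≢w false true =
    let x , px , x≢v , x≢w = another-neighbour deg v w
    in ⁅ w , x ⁆ , ⁅,⁆-even pw px (x≢w ∘ sym) , ∉⁅,⁆ v≢w (x≢v ∘ sym) , ∈⁅,⁆ˡ w x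

  even-outside-nbr : ∀ {u} {S : Subset n} → Even u S → ∀ {x} → adj G u x ≡ false → lookup S x ≡ false
  even-outside-nbr {u} {S} q {x} ¬ux with lookup S x in x∈S
  ... | false = refl
  ... | true = ⊥-elim (subst T ¬ux (even⇒⊆nbr {u} {S} q x x∈S))

  Deg≤2⇒even-constant : ∀ {u v x} {S : Subset n} → Deg≤2 u → Adj u v → Adj u x → x ≢ v → Even u S →
    lookup S v ≡ lookup S x
  Deg≤2⇒even-constant {u} {v} {x} {S} deg pv px x≢v q =
    even⇒≡ _ _ (subst (T ∘ evenᵇ) (∣∣-⊆⁅v,w⁆ S (x≢v ∘ sym) ⊆⁅v,x⁆) (proj₂ (Equivalence.to T-∧ q)))
    where
      ⊆⁅v,x⁆ : ∀ y → lookup S y ≡ true → y ≡ v ⊎ y ≡ x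
      ⊆⁅v,x⁆ y y∈S with deg pv px (even⇒⊆nbr {u} {S} q y y∈S)
      ... | inj₁ v≡x = ⊥-elim (x≢v (sym v≡x))
      ... | inj₂ (inj₁ v≡y) = inj₁ (sym v≡y)
      ... | inj₂ (inj₂ x≡y) = inj₂ (sym x≡y)

  Deg≤2⇒even-determined : ∀ {u v} {S S' : Subset n} → Deg≤2 u → Adj u v → Even u S → Even u S' →
    lookup S v ≡ lookup S' v → S ≡ S'
  Deg≤2⇒even-determined {u} {v} {S} {S'} deg pv q q' Sv≡S'v = lookup-ext S S' agree
    where
      agree : ∀ x → lookup S x ≡ lookup S' x
      agree x with x ≟ v
      ... | yes refl = Sv≡S'v
      ... | no x≢v with adj G u x in ux
      ...   | false = trans (even-outside-nbr {u} {S} q ux) (sym (even-outside-nbr {u} {S'} q' ux))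
      ...   | true = begin
        lookup S x   ≡⟨ Deg≤2⇒even-constant {S = S} deg pv px x≢v q ⟨
        lookup S v   ≡⟨ Sv≡S'v ⟩
        lookup S' v  ≡⟨ Deg≤2⇒even-constant {S = S'} deg pv px x≢v q' ⟩
        lookup S' x  ∎
        where open ≡-Reasoning
              px : Adj u x
              px = Equivalence.from T-≡ ux

  Symmetric : (Fin n → Fin n → Bool) → Set
  Symmetric tw = ∀ u v → tw u v ≡ tw v u

  m∅ : Fin n → V
  m∅ u = m u ⊥ (⊥-even u)

  module Edges (tw : Fin n → Fin n → Bool) (tw-sym : Symmetric tw) where

    E : V → V → Set
    E = Edge G tw

    E-sym : ∀ {x y} → E x y → E y x
    E-sym = ⊎.swap

    port─m : ∀ k {u v p S q} → lookup S v ≡ k → E (port k u v p) (m u S q)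
    port─m true Sv≡k = inj₁ (am Sv≡k)
    port─m false Sv≡k = inj₁ (bm Sv≡k)

    partner : Bool → (u v : Fin n) → Adj u v → V
    partner k u v p = port (k xor tw u v) v u (adj-sym p)

    port─partner : ∀ k u v p → E (port k u v p) (partner k u v p)
    port─partner true u v p with tw u v in eq
    ... | false = inj₁ (aa eq)
    ... | true = inj₁ (ab eq)
    port─partner false u v p with tw u v in eq
    ... | false = inj₁ (bb eq)
    ... | true = inj₁ (ba eq)

    InnerNeighbour : Fin n → Fin n → Bool → V → Set
    InnerNeighbour u v k y = Σ (Subset n) λ S → Σ (Even u S) λ q → y ≡ m u S q × lookup S v ≡ k

    IsPartner : Fin n → Fin n → Bool → V → Set
    IsPartner u v k y = Σ (Adj v u) λ p' → y ≡ port (k xor tw u v) v u p'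

    port-neighbours : ∀ k {u v p y} → E (port k u v p) y → InnerNeighbour u v k y ⊎ IsPartner u v k y
    port-neighbours true (inj₁ (am e)) = inj₁ (_ , _ , refl , e)
    port-neighbours true (inj₁ (aa e)) rewrite e = inj₂ (_ , refl)
    port-neighbours true (inj₁ (ab e)) rewrite e = inj₂ (_ , refl)
    port-neighbours true {u} {v} (inj₂ (aa e)) rewrite trans (tw-sym u v) e = inj₂ (_ , refl)
    port-neighbours true {u} {v} (inj₂ (ba e)) rewrite trans (tw-sym u v) e = inj₂ (_ , refl)
    port-neighbours false (inj₁ (bm e)) = inj₁ (_ , _ , refl , e)
    port-neighbours false (inj₁ (bb e)) rewrite e = inj₂ (_ , refl)
    port-neighbours false (inj₁ (ba e)) rewrite e = inj₂ (_ , refl)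
    port-neighbours false {u} {v} (inj₂ (bb e)) rewrite trans (tw-sym u v) e = inj₂ (_ , refl)
    port-neighbours false {u} {v} (inj₂ (ab e)) rewrite trans (tw-sym u v) e = inj₂ (_ , refl)

    m-neighbours : ∀ {u S q y} → E (m u S q) y → ∃ λ v → Σ (Adj u v) λ p → y ≡ port (lookup S v) u v p
    m-neighbours (inj₂ (am {v = v} {p = p} e)) = v , p , cong (λ k → port k _ v p) (sym e)
    m-neighbours (inj₂ (bm {v = v} {p = p} e)) = v , p , cong (λ k → port k _ v p) (sym e)

    partner-unique : ∀ {u v} k {y y'} → IsPartner u v k y → IsPartner u v k y' → y ≡ y'
    partner-unique k (p , refl) (p' , refl) = port-cong _ refl

    inner-unique : ∀ {u v} k {y y'} → Deg≤2 u → Adj u v →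
      InnerNeighbour u v k y → InnerNeighbour u v k y' → y ≡ y'
    inner-unique k deg pv (S , q , refl , Sv≡k) (S' , q' , refl , S'v≡k) =
      m-cong (Deg≤2⇒even-determined {S = S} {S'} deg pv q q' (trans Sv≡k (sym S'v≡k)))

    partner-involutive : ∀ k u v p → IsPartner v u (k xor tw u v) (port k u v p)
    partner-involutive k u v p = p , (begin
      port k u v p                            ≡⟨ cong (λ k' → port k' u v p) (xor-cancelʳ k (tw u v)) ⟨
      port ((k xor tw u v) xor tw u v) u v p  ≡⟨ cong (λ c → port ((k xor tw u v) xor c) u v p) (tw-sym u v) ⟩
      port ((k xor tw u v) xor tw v u) u v p  ∎)
      where open ≡-Reasoning

  module Soundness (tw : Fin n → Fin n → Bool) (tw-sym : Symmetric tw) where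
    open Edges tw tw-sym
    open Intrinsic E

    port-low : ∀ {u} → Deg≤2 u → ∀ k v p → Low (port k u v p)
    port-low deg k v p e₁ e₂ e₃
      with port-neighbours k e₁ | port-neighbours k e₂ | port-neighbours k e₃
    ... | inj₁ i₁ | inj₁ i₂ | _       = inj₁ (inner-unique k deg p i₁ i₂)
    ... | inj₁ i₁ | inj₂ _  | inj₁ i₃ = inj₂ (inj₁ (inner-unique k deg p i₁ i₃))
    ... | inj₁ _  | inj₂ p₂ | inj₂ p₃ = inj₂ (inj₂ (partner-unique k p₂ p₃))
    ... | inj₂ _  | inj₁ i₂ | inj₁ i₃ = inj₂ (inj₂ (inner-unique k deg p i₂ i₃))
    ... | inj₂ p₁ | inj₁ _  | inj₂ p₃ = inj₂ (inj₁ (partner-unique k p₁ p₃))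
    ... | inj₂ p₁ | inj₂ p₂ | _       = inj₁ (partner-unique k p₁ p₂)

    m-low : ∀ {u S q} → Deg≤2 u → Low (m u S q)
    m-low {u} {S} deg e₁ e₂ e₃ with m-neighbours e₁ | m-neighbours e₂ | m-neighbours e₃
    ... | _ , p₁ , refl | _ , p₂ , refl | _ , p₃ , refl =
      ⊎.map same-port (⊎.map same-port same-port) (deg p₁ p₂ p₃)
      where
        same-port : ∀ {v v' p p'} → v ≡ v' → port (lookup S v) u v p ≡ port (lookup S v') u v' p'
        same-port refl = port-cong _ refl

    Deg≤2⇒Low : ∀ {u} → Deg≤2 u → ∀ x → owner G x ≡ u → Low x
    Deg≤2⇒Low deg (a _ v p) refl = port-low deg true v p
    Deg≤2⇒Low deg (b _ v p) refl = port-low deg false v p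
    Deg≤2⇒Low deg (m _ S q) refl = m-low deg

    m-high : ∀ {u S q} → Deg≥3 u → High (m u S q)
    m-high {u} {S} (v₁ , v₂ , v₃ , p₁ , p₂ , p₃ , v₁≢v₂ , v₁≢v₃ , v₂≢v₃) =
      port (lookup S v₁) u v₁ p₁ , port (lookup S v₂) u v₂ p₂ , port (lookup S v₃) u v₃ p₃ ,
      E-sym (port─m _ refl) , E-sym (port─m _ refl) , E-sym (port─m _ refl) ,
      v₁≢v₂ ∘ port-target-injective , v₁≢v₃ ∘ port-target-injective ,
      v₂≢v₃ ∘ port-target-injective

    port-high : ∀ {u} → Deg≥3 u → ∀ k v p → High (port k u v p)
    port-high {u} deg k v p with another-neighbour deg v v
    ... | w , pw , w≢v , _
      with even-prescribed deg p pw (w≢v ∘ sym) k (not k) | even-agreeing p pw (w≢v ∘ sym) k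
    ... | S₁ , q₁ , S₁v≡k , S₁w≡¬k | S₂ , q₂ , S₂v≡k , S₂w≡k =
      partner k u v p , m u S₁ q₁ , m u S₂ q₂ ,
      port─partner k u v p , port─m k S₁v≡k , port─m k S₂v≡k ,
      m≢port ∘ sym , m≢port ∘ sym ,
      λ eq → not-¬ refl (trans (sym S₂w≡k) (trans (cong (λ S → lookup S w) (sym (m-injective eq))) S₁w≡¬k))

    Deg≥3⇒High : ∀ {u} → Deg≥3 u → ∀ x → owner G x ≡ u → High x
    Deg≥3⇒High deg (a _ v p) refl = port-high deg true v p
    Deg≥3⇒High deg (b _ v p) refl = port-high deg false v p
    Deg≥3⇒High deg (m _ S q) refl = m-high deg

    hexagon-port : ∀ k {u v p x₁ x₂ x₃ x₄ x₅} →
      E (port k u v p) x₁ → E x₁ x₂ → E x₂ x₃ → E x₃ x₄ → E x₄ x₅ → E x₅ (port k u v p) →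
      x₅ ≢ x₁ → x₂ ≢ port k u v p → x₁ ≢ x₃ → u ≡ owner G x₁
    hexagon-port k {u} {v} {p} e₀ e₁ e₂ e₃ e₄ e₅ x₅≢x₁ x₂≢x₀ x₁≢x₃ with port-neighbours k e₀
    ... | inj₁ (_ , _ , refl , _) = refl
    ... | inj₂ (p' , refl) with port-neighbours k (E-sym e₅)
    ...   | inj₂ x₅-partner = ⊥-elim (x₅≢x₁ (partner-unique k x₅-partner (p' , refl)))
    ...   | inj₁ (_ , _ , refl , _) with port-neighbours (k xor tw u v) e₁
    ...     | inj₂ x₂-partner =
      ⊥-elim (x₂≢x₀ (partner-unique (k xor tw u v) x₂-partner (partner-involutive k u v p)))
    ...     | inj₁ (S₂ , _ , refl , S₂u≡k') with m-neighbours e₂ | m-neighbours (E-sym e₄)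
    ...       | w , _ , refl | _ , _ , refl with port-neighbours (lookup S₂ w) e₃
    ...         | inj₁ (_ , _ , x₄≡m , _) = ⊥-elim (m≢port (sym x₄≡m))
    ...         | inj₂ (_ , x₄≡port) with refl ← proj₁ (proj₂ (port-injective x₄≡port)) =
                  ⊥-elim (x₁≢x₃ (trans (cong (λ k' → port k' v u p') (sym S₂u≡k')) (port-cong _ refl)))

    hexagon-sound : ∀ {x₀ x₁ x₂ x₃ x₄ x₅} →
      E x₀ x₁ → E x₁ x₂ → E x₂ x₃ → E x₃ x₄ → E x₄ x₅ → E x₅ x₀ →
      x₅ ≢ x₁ → x₂ ≢ x₀ → x₁ ≢ x₃ → owner G x₀ ≡ owner G x₁
    hexagon-sound {a u v p} = hexagon-port true
    hexagon-sound {b u v p} = hexagon-port false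
    hexagon-sound {m u S q} e₀ _ _ _ _ _ _ _ _ with m-neighbours e₀
    ... | v , p , refl = sym (owner-port (lookup S v) u v p)

    fork-port : ∀ k {u v p x y} → E (port k u v p) x → E (port k u v p) y → x ≢ y →
      owner G x ≡ owner G y → u ≡ owner G x
    fork-port k e₁ e₂ x≢y ox≡oy with port-neighbours k e₁
    ... | inj₁ (_ , _ , refl , _) = refl
    ... | inj₂ x-partner with port-neighbours k e₂
    ...   | inj₁ (_ , _ , refl , _) = sym ox≡oy
    ...   | inj₂ y-partner = ⊥-elim (x≢y (partner-unique k x-partner y-partner))

    fork-sound : ∀ {z x y} → E z x → E z y → x ≢ y → owner G x ≡ owner G y → owner G z ≡ owner G x
    fork-sound {a u v p} = fork-port true
    fork-sound {b u v p} = fork-port false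
    fork-sound {m u S q} e₁ _ _ _ with m-neighbours e₁
    ... | v , p , refl = sym (owner-port (lookup S v) u v p)

    High⇒Deg≥3 : ∀ {x} → High x → Deg≥3 (owner G x)
    High⇒Deg≥3 {x} high with Deg≥3? (owner G x)
    ... | yes deg = deg
    ... | no ¬deg = ⊥-elim (Has≥3⇒¬Has≤2 high (Deg≤2⇒Low (¬Deg≥3⇒Deg≤2 ¬deg) x refl))

    Low⇒Deg≤2 : ∀ {x} → Low x → Deg≤2 (owner G x)
    Low⇒Deg≤2 {x} low = ¬Deg≥3⇒Deg≤2 λ deg → Has≥3⇒¬Has≤2 (Deg≥3⇒High deg x refl) low

    Attached : Fin n → Fin n → V → V → Set
    Attached u v x y = Σ Bool λ k → Σ (Adj u v) λ p → y ≡ port k u v p × IsPartner u v k x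

    Attached⇒owner : ∀ {u v x y} → Attached u v x y → owner G y ≡ u
    Attached⇒owner (k , p , refl , _) = owner-port k _ _ p

    Aligned : V → V → V → V → Set
    Aligned x y x' y' = ∃₂ λ u v → Deg≤2 u × Adj u v × Attached u v x y × Attached u v x' y'

    forward-inner : ∀ {u v x y z} → (att : Attached u v x y) → Forward x y z →
      InnerNeighbour u v (proj₁ att) z
    forward-inner (k , p , refl , x-partner) (e , z≢x) with port-neighbours k e
    ... | inj₁ inner = inner
    ... | inj₂ z-partner = ⊥-elim (z≢x (partner-unique k z-partner x-partner))

    port-low-neighbour : ∀ k {u v p y} → Deg≥3 u → E (port k u v p) y → Low y →
      ∃ λ w → Attached w u (port k u v p) y
    port-low-neighbour k {u} {v} {p} deg e low with port-neighbours k e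
    ... | inj₁ (_ , _ , refl , _) = ⊥-elim (Has≥3⇒¬Has≤2 (m-high deg) low)
    ... | inj₂ (p' , refl) = v , k xor tw u v , p' , refl , partner-involutive k u v p

    low-neighbour-attached : ∀ {o h y} → Deg≥3 o → owner G h ≡ o → E h y → Low y →
      ∃ λ w → Attached w o h y
    low-neighbour-attached {h = a u v p} deg refl = port-low-neighbour true deg
    low-neighbour-attached {h = b u v p} deg refl = port-low-neighbour false deg
    low-neighbour-attached {h = m u S q} deg refl e low with m-neighbours e
    ... | v , p , refl = ⊥-elim (Has≥3⇒¬Has≤2 (port-high deg _ v p) low)

    attachments-share-neighbour : ∀ {o u u' x y x' y'} → Deg≥3 o →
      Attached u o x y → Attached u' o x' y' → u ≢ u' → ∃ λ z → E x z × E x' z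
    attachments-share-neighbour deg (k , _ , _ , p , refl) (k' , _ , _ , p' , refl) u≢u'
      with even-prescribed deg p p' u≢u' _ _
    ... | S , q , Su , Su' = m _ S q , port─m _ Su , port─m _ Su'

    root-sound : ∀ {h h' y y'} → High h → owner G h ≡ owner G h' → NoCommonNeighbour h h' →
      E h y → E h' y' → Low y → Low y' → Aligned h y h' y'
    root-sound high oh≡oh' nc e e' low low'
      with low-neighbour-attached (High⇒Deg≥3 high) refl e low
         | low-neighbour-attached (High⇒Deg≥3 high) (sym oh≡oh') e' low'
    ... | u , att | u' , att' with u ≟ u'
    ...   | yes refl =
      u , _ , subst Deg≤2 (Attached⇒owner att) (Low⇒Deg≤2 low) , proj₁ (proj₂ att) , att , att'
    ...   | no u≢u' =
      let z , hz , h'z = attachments-share-neighbour (High⇒Deg≥3 high) att att' u≢u'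
      in ⊥-elim (nc z hz h'z)

    advance-attached : ∀ {u v x y w t} → Deg≤2 u → Attached u v x y → Advance x y w t →
      ∃ λ v₂ → v₂ ≢ v × Adj v₂ u × Attached v₂ u w t
    advance-attached {u} {v} deg att@(k , p , refl , _) (_ , fz , (zw , w≢y) , (wt , t≢z) , _)
      with forward-inner att fz
    ... | S , q , refl , Sv≡k with m-neighbours zw
    ...   | v₂ , p₂ , refl with port-neighbours (lookup S v₂) wt
    ...     | inj₁ inner = ⊥-elim (t≢z (inner-unique _ deg p₂ inner (S , q , refl , refl)))
    ...     | inj₂ (p₃ , refl) =
      v₂ , v₂≢v , p₃ , (_ , p₃ , refl , partner-involutive (lookup S v₂) u v₂ p₂)
      where
        v₂≢v : v₂ ≢ v
        v₂≢v refl = w≢y (trans (port-cong (lookup S v) refl) (cong (λ k' → port k' u v p) Sv≡k))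

    advance-sound : ∀ {x y x' y' w t w' t'} →
      Aligned x y x' y' → Advance x y w t → Advance x' y' w' t' → Aligned w t w' t'
    advance-sound (u , v , deg , pv , att , att') adv@(_ , _ , _ , _ , low) adv'
      with advance-attached deg att adv | advance-attached deg att' adv'
    ... | v₂ , v₂≢v , p₂ , att₂ | v₂' , v₂'≢v , p₂' , att₂' with deg pv (adj-sym p₂) (adj-sym p₂')
    ...   | inj₁ v≡v₂ = ⊥-elim (v₂≢v (sym v≡v₂))
    ...   | inj₂ (inj₁ v≡v₂') = ⊥-elim (v₂'≢v (sym v≡v₂'))
    ...   | inj₂ (inj₂ refl) =
      v₂ , u , subst Deg≤2 (Attached⇒owner att₂) (Low⇒Deg≤2 low) , p₂ , att₂ , att₂'

    ∼-sound : ∀ {x y} → x ∼ y → owner G x ≡ owner G y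
    Parallel-sound : ∀ {x y x' y'} → Parallel x y x' y' → Aligned x y x' y'
    ∼-sound ∼-refl = refl
    ∼-sound (∼-sym r) = sym (∼-sound r)
    ∼-sound (∼-trans r r') = trans (∼-sound r) (∼-sound r')
    ∼-sound (hexagon e₀ e₁ e₂ e₃ e₄ e₅ n₁ n₂ n₃) = hexagon-sound e₀ e₁ e₂ e₃ e₄ e₅ n₁ n₂ n₃
    ∼-sound (fork e₁ e₂ x≢y r) = fork-sound e₁ e₂ x≢y (∼-sound r)
    ∼-sound (parallel par) with Parallel-sound par
    ... | _ , _ , _ , _ , att , att' = trans (Attached⇒owner att) (sym (Attached⇒owner att'))
    ∼-sound (forward₁ par f) with Parallel-sound par
    ... | _ , _ , _ , _ , att , _ with forward-inner att f
    ...   | _ , _ , refl , _ = Attached⇒owner att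
    ∼-sound (forward₂ par f (zw , _)) with Parallel-sound par
    ... | _ , _ , _ , _ , att , _ with forward-inner att f
    ...   | S , _ , refl , _ with m-neighbours zw
    ...     | v₂ , p₂ , refl = sym (owner-port (lookup S v₂) _ v₂ p₂)
    Parallel-sound (root high _ r nc e e' l l') = root-sound high (∼-sound r) nc e e' l l'
    Parallel-sound (advance par adv adv') = advance-sound (Parallel-sound par) adv adv'

  data Chain : Fin n → Fin n → Set where
    start : ∀ {x u} → Deg≥3 x → Adj x u → ¬ Deg≥3 u → Chain x u
    extend : ∀ {p u w} → Chain p u → Adj u w → w ≢ p → ¬ Deg≥3 w → Chain u w

  walk⇒chain : ∀ {u x₀} → ¬ Deg≥3 u → Walk G u x₀ → Deg≥3 x₀ → ∃ λ p → Chain p u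
  walk⇒chain ¬deg here deg = ⊥-elim (¬deg deg)
  walk⇒chain {u} ¬deg (step {v = v} puv walk) deg with Deg≥3? v
  ... | yes degv = v , start degv (adj-sym puv) ¬deg
  ... | no ¬degv with walk⇒chain ¬degv walk deg
  ...   | q , chain with q ≟ u
  ...     | no q≢u = v , extend chain (adj-sym puv) (q≢u ∘ sym) ¬deg
  ...     | yes refl with chain
  ...       | start degq _ _ = ⊥-elim (¬deg degq)
  ...       | extend {p = r} chain' _ _ _ = r , chain'

  module Completeness (tw : Fin n → Fin n → Bool) (tw-sym : Symmetric tw) where
    open Edges tw tw-sym
    open Intrinsic E
    open Soundness tw tw-sym using (port-low; port-high)

    Centred : Fin n → Set
    Centred u = ∃ λ y₀ → ∀ x → owner G x ≡ u → x ∼ y₀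

    gadget-hexagon : ∀ {u i j k} (pi : Adj u i) (pj : Adj u j) (pk : Adj u k) → i ≢ j → i ≢ k → j ≢ k →
      b u i pi ∼ m∅ u × a u k pk ∼ m∅ u
    gadget-hexagon {u} {i} {j} {k} pi pj pk i≢j i≢k j≢k =
      let bᵢ∼m∅ , _ , _ , _ , aₖ∼mⱼₖ , mⱼₖ∼bᵢ = hexagon-links e₀ e₁ e₂ e₃ e₄ e₅
            (i≢j ∘ port-target-injective) (m-separated (∈⁅,⁆ˡ i k) (lookup-replicate i false) ∘ sym)
            (λ ()) (m-separated (∈⁅,⁆ˡ i k) (∉⁅,⁆ i≢j i≢k))
            (λ ()) (m-separated (∈⁅,⁆ˡ j k) (lookup-replicate j false))
      in bᵢ∼m∅ , ∼-trans aₖ∼mⱼₖ (∼-trans mⱼₖ∼bᵢ bᵢ∼m∅)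
      where
        mᵢₖ mⱼₖ : V
        mᵢₖ = m u ⁅ i , k ⁆ (⁅,⁆-even pi pk i≢k)
        mⱼₖ = m u ⁅ j , k ⁆ (⁅,⁆-even pj pk j≢k)
        e₀ : E (b u i pi) (m∅ u)
        e₀ = port─m false (lookup-replicate i false)
        e₁ : E (m∅ u) (b u j pj)
        e₁ = E-sym (port─m false (lookup-replicate j false))
        e₂ : E (b u j pj) mᵢₖ
        e₂ = port─m false (∉⁅,⁆ (i≢j ∘ sym) j≢k)
        e₃ : E mᵢₖ (a u k pk)
        e₃ = E-sym (port─m true (∈⁅,⁆ʳ i k))
        e₄ : E (a u k pk) mⱼₖ
        e₄ = port─m true (∈⁅,⁆ʳ j k)
        e₅ : E mⱼₖ (b u i pi)
        e₅ = E-sym (port─m false (∉⁅,⁆ i≢j i≢k))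

    port-∼-m∅ : ∀ {u} → Deg≥3 u → ∀ k v p → port k u v p ∼ m∅ u
    port-∼-m∅ deg true v p with two-other-neighbours deg v
    ... | i , j , pi , pj , i≢j , i≢v , j≢v = proj₂ (gadget-hexagon pi pj p i≢j i≢v j≢v)
    port-∼-m∅ deg false v p with two-other-neighbours deg v
    ... | j , k , pj , pk , j≢k , j≢v , k≢v = proj₁ (gadget-hexagon p pj pk (j≢v ∘ sym) (k≢v ∘ sym) j≢k)

    Deg≥3⇒centred : ∀ {u} → Deg≥3 u → Centred u
    Deg≥3⇒centred {u} deg = m∅ u , linked
      where
        linked : ∀ x → owner G x ≡ u → x ∼ m∅ u
        linked (a _ v p) refl = port-∼-m∅ deg true v p
        linked (b _ v p) refl = port-∼-m∅ deg false v p
        linked (m _ S q) refl =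
          let v₁ , v₂ , _ , p₁ , p₂ , _ , v₁≢v₂ , _ = deg
              port₁∼m∅ = port-∼-m∅ deg (lookup S v₁) v₁ p₁
              port₂∼m∅ = port-∼-m∅ deg (lookup S v₂) v₂ p₂
          in ∼-trans (fork (E-sym (port─m _ refl)) (E-sym (port─m _ refl)) (v₁≢v₂ ∘ port-target-injective)
                           (∼-trans port₁∼m∅ (∼-sym port₂∼m∅)))
                     port₁∼m∅

    a-b-no-common-neighbour : ∀ x u p → NoCommonNeighbour (a x u p) (b x u p)
    a-b-no-common-neighbour x u p z e₁ e₂ with port-neighbours true e₁ | port-neighbours false e₂
    ... | inj₁ (_ , _ , refl , u∈S) | inj₁ (_ , _ , eq , u∉S') = m-separated u∈S u∉S' eq
    ... | inj₁ (_ , _ , refl , _) | inj₂ (_ , eq) = m≢port eq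
    ... | inj₂ (_ , refl) | inj₁ (_ , _ , eq , _) = m≢port (sym eq)
    ... | inj₂ (_ , refl) | inj₂ (_ , eq) = not-¬ refl (sym (proj₁ (port-injective eq)))

    advance-through : ∀ {p u w x} k (pp : Adj u p) (pw : Adj u w) → w ≢ p → ¬ Deg≥3 w → owner G x ≡ p →
      Advance x (port k u p pp) (port k u w pw) (partner k u w pw)
    advance-through {p} {u} {w} k pp pw w≢p ¬deg ox with even-agreeing pp pw (w≢p ∘ sym) k
    ... | S , q , Sp≡k , Sw≡k =
      m u S q ,
      (port─m k Sp≡k , λ eq → adj⇒≢ pp (trans (cong (owner G) eq) ox)) ,
      (E-sym (port─m k Sw≡k) , w≢p ∘ port-target-injective) ,
      (port─partner k u w pw , m≢port ∘ sym) ,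
      port-low (¬Deg≥3⇒Deg≤2 ¬deg) (k xor tw u w) u (adj-sym pw)

    chain-parallel : ∀ {p u} → Chain p u → Σ Bool λ k → Σ (Adj u p) λ pp → ∃₂ λ x x' →
      Parallel x (port k u p pp) x' (port (not k) u p pp) × owner G x ≡ p × owner G x' ≡ p
    chain-parallel (start {x} {u} deg pxu ¬deg) =
      tw x u , adj-sym pxu , b x u pxu , a x u pxu ,
      root (port-high deg false u pxu) (port-high deg true u pxu)
           (∼-trans (port-∼-m∅ deg false u pxu) (∼-sym (port-∼-m∅ deg true u pxu)))
           (flip ∘ a-b-no-common-neighbour x u pxu)
           (port─partner false x u pxu) (port─partner true x u pxu)
           (port-low (¬Deg≥3⇒Deg≤2 ¬deg) (tw x u) x (adj-sym pxu))
           (port-low (¬Deg≥3⇒Deg≤2 ¬deg) (not (tw x u)) x (adj-sym pxu)) ,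
      refl , refl
    chain-parallel (extend {p} {u} {w} chain pw w≢p ¬deg) with chain-parallel chain
    ... | k , pp , x , x' , par , ox , ox' =
      k xor tw u w , adj-sym pw , port k u w pw , port (not k) u w pw ,
      subst (Parallel _ _ _) (cong (λ k' → port k' w u (adj-sym pw)) (sym (not-distribˡ-xor k (tw u w))))
        (advance par (advance-through k pp pw w≢p ¬deg ox) (advance-through (not k) pp pw w≢p ¬deg ox')) ,
      owner-port k u w pw , owner-port (not k) u w pw

    -- When deg u ≤ 2, Y(u) consists of two paths; half p z tells which one contains z.
    half : Fin n → V → Bool
    half _ (a _ _ _) = true
    half _ (b _ _ _) = false
    half p (m _ S _) = lookup S p

    parallel-half-linked : ∀ {p u x x' y'} k (pp : Adj u p) →
      Parallel x (port k u p pp) x' y' → owner G x ≡ p →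
      ∀ z → owner G z ≡ u → half p z ≡ k → z ∼ port k u p pp
    parallel-half-linked {p} {u} {x} k pp par ox = linked
      where
        m≢x : ∀ {S q} → m u S q ≢ x
        m≢x eq = adj⇒≢ pp (trans (cong (owner G) eq) ox)
        port-linked : ∀ {v} (pv : Adj u v) → port k u v pv ∼ port k u p pp
        port-linked {v} pv with v ≟ p
        ... | yes refl = ∼-reflexive (port-cong k refl)
        ... | no v≢p with even-agreeing pp pv (v≢p ∘ sym) k
        ...   | S , q , Sp≡k , Sv≡k =
          let y→m = port─m k {S = S} {q} Sp≡k , m≢x
              m→v = E-sym (port─m k {S = S} {q} Sv≡k) , v≢p ∘ port-target-injective
          in ∼-sym (∼-trans (forward₁ par y→m) (forward₂ par y→m m→v))
        linked : ∀ z → owner G z ≡ u → half p z ≡ k → z ∼ port k u p pp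
        linked (a _ v pv) refl refl = port-linked pv
        linked (b _ v pv) refl refl = port-linked pv
        linked (m _ S q) refl Sp≡k = ∼-sym (forward₁ par (port─m k Sp≡k , m≢x))

    chain-end-centred : ∀ {p u} → Chain p u → Centred u
    chain-end-centred {p} {u} chain with chain-parallel chain
    ... | k , pp , x , x' , par , ox , ox' = port k u p pp , linked
      where
        linked : ∀ z → owner G z ≡ u → z ∼ port k u p pp
        linked z oz with half p z ≟ᵇ k
        ... | yes same = parallel-half-linked k pp par ox z oz same
        ... | no other = ∼-trans (parallel-half-linked (not k) pp (Parallel-swap par) ox' z oz (¬-not other))
                                 (∼-sym (parallel par))

    gadget-centred : Connected G → ∀ {x₀} → Deg≥3 x₀ → ∀ u → Centred u
    gadget-centred conn deg₀ u with Deg≥3? u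
    ... | yes deg = Deg≥3⇒centred deg
    ... | no ¬deg = chain-end-centred (proj₂ (walk⇒chain ¬deg (conn u _) deg₀))

    ∼-complete : Connected G → ∀ {x₀} → Deg≥3 x₀ → ∀ {x y} → owner G x ≡ owner G y → x ∼ y
    ∼-complete conn deg₀ {x} {y} ox≡oy =
      let _ , linked = gadget-centred conn deg₀ (owner G x)
      in ∼-trans (linked x refl) (∼-sym (linked y (sym ox≡oy)))

  graphIso-owner-preserved : Connected G → ∀ {x₀} → Deg≥3 x₀ →
    ∀ {tw₁ tw₂} → Symmetric tw₁ → Symmetric tw₂ →
    (ψ : GraphIso (Edge G tw₁) (Edge G tw₂)) → ∀ {x y} →
    owner G x ≡ owner G y → owner G (GraphIso.to ψ x) ≡ owner G (GraphIso.to ψ y)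
  graphIso-owner-preserved conn deg₀ {tw₁} {tw₂} sym₁ sym₂ ψ =
    Soundness.∼-sound tw₂ sym₂ ∘ ∼-preserved ψ ∘ Completeness.∼-complete tw₁ sym₁ conn deg₀

  iso-gadget-preserving : Connected G → ∀ {x₀} → Deg≥3 x₀ →
    ∀ {tw₁ tw₂} → Symmetric tw₁ → Symmetric tw₂ →
    (φ : Iso G (Edge G tw₁) (Edge G tw₂)) → GadgetPreserving G φ
  iso-gadget-preserving conn deg₀ sym₁ sym₂ φ u =
    owner G (to (m∅ u)) ,
    (λ x ox → graphIso-owner-preserved conn deg₀ sym₁ sym₂ ψ ox) ,
    λ y oy → from y ,
      trans (graphIso-owner-preserved conn deg₀ sym₂ sym₁ (GraphIso.inverse ψ) oy)
            (cong (owner G) (strictlyInverseʳ (m∅ u))) ,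
      strictlyInverseˡ y
    where
      ψ : GraphIso (Edge G _) (Edge G _)
      ψ = record { bijection = ⤖⇒↔ (Iso.bij φ) ; preserves = Iso.pres φ _ _ ; reflects = Iso.refl φ _ _ }
      open GraphIso ψ

twist-symmetric : ∀ {n} (G : Graph n) u₀ v₀ → Gadgets.Symmetric G (twist G u₀ v₀)
twist-symmetric G u₀ v₀ u v =
  trans (cong₂ _∨_ (∧-comm ⌊ u ≟ u₀ ⌋ ⌊ v ≟ v₀ ⌋) (∧-comm ⌊ u ≟ v₀ ⌋ ⌊ v ≟ u₀ ⌋))
        (∨-comm (⌊ v ≟ v₀ ⌋ ∧ ⌊ u ≟ u₀ ⌋) (⌊ v ≟ u₀ ⌋ ∧ ⌊ u ≟ v₀ ⌋))

proposition7p10 : ∀ {n : ℕ} (G : Graph n) → 2 ≤ n → Connected G → MaxDegree≥3 G →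
    ((φ : Iso G (EY G) (EY G)) → GadgetPreserving G φ) ×
    (∀ u0 v0 → T (adj G u0 v0) → (φ : Iso G (EY G) (EỸ G u0 v0)) → GadgetPreserving G φ)
proposition7p10 G _ conn (x₀ , 3≤∣N∣) =
  iso-gadget-preserving conn deg untwisted untwisted ,
  λ u₀ v₀ _ → iso-gadget-preserving conn deg untwisted (twist-symmetric G u₀ v₀)
  where
    open Gadgets G
    deg : Deg≥3 x₀
    deg = ∣nbr∣≥3⇒Deg≥3 3≤∣N∣
    untwisted : Symmetric λ _ _ → false
    untwisted _ _ = refl
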